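{- Every Matoušek AUSO $f$ on $n$ bits is both $<$-smooth (for the usual order $<$ on $[n]$) and semismooth.
   Context: A Matoušek AUSO is $f:\{0,1\}^n\to\mathbb{Z}$, $f(x)=-\sum_{i=1}^n2^{n-i}P_i(x[R_i])$, where $i\in R_i\subseteq[i]$, $x[R_i]$ is the restriction of $x$ to $R_i$, and $P_i$ is the parity function on $\{0,1\}^{R_i}$. $x[j\mapsto b]$ denotes $x$ with bit $j$ set to $b$. For a strict partial order $\prec$ on $[n]$ and $\downarrow j=\{i:i\prec j\}$, $f$ is $\prec$-smooth if there exists $x^*\in\{0,1\}^n$ such that for all $j$ and all $x$ with $x[\downarrow j]=x^*[\downarrow j]$, $f(x[j\mapsto x^*_j])>f(x[j\mapsto\overline{x^*_j}])$. For $S\subseteq[n]$ and $y\in\{0,1\}^{[n]\setminus S}$, the face $\{0,1\}^Sy$ is the set of $x$ with $x[[n]\setminus S]=y$; $x$ is a local peak of the face if $f(x)\ge f(x[i\mapsto\bar x_i])$ for all $i\in S$. $f$ is semismooth if every face has exactly one local peak. -}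

module Defs where

open import Data.Nat as ℕ using (ℕ; zero; suc; _^_; _∸_)
open import Data.Integer as ℤ using (ℤ; +_; -_; _>_; _≥_)
open import Data.Bool using (Bool; true; false; not; if_then_else_; _xor_; _∧_)
open import Data.Fin using (Fin; toℕ) renaming (zero to fzero; suc to fsuc)
open import Data.Fin.Subset using (Subset; _∈_; _∉_)
open import Data.Vec using (Vec; lookup; _[_]≔_)
open import Data.Product using (∃; ∃!; _×_)
open import Relation.Binary.PropositionalEquality using (_≡_)

-- Points of the cube {0,1}^n, coordinate i ∈ Fin n (0-based: Fin index k is bit k+1).
Point : ℕ → Set
Point n = Vec Bool n

sumFin : ∀ {n} → (Fin n → ℕ) → ℕ
sumFin {zero}  g = 0
sumFin {suc n} g = g fzero ℕ.+ sumFin (λ i → g (fsuc i))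

parityFin : ∀ {n} → (Fin n → Bool) → Bool
parityFin {zero}  b = false
parityFin {suc n} b = b fzero xor parityFin (λ i → b (fsuc i))

parityOn : ∀ {n} → Subset n → Point n → Bool
parityOn R x = parityFin (λ j → lookup R j ∧ lookup x j)

bit : Bool → ℕ
bit true  = 1
bit false = 0

-- Matoušek function f(x) = - Σ_i 2^{n-i} P_i(x[R_i])   (with 1-based i; here
-- Fin index k corresponds to i = k+1, so the weight is 2^(n ∸ (k+1))).
matousek : ∀ {n} → (Fin n → Subset n) → Point n → ℤ
matousek {n} R x =
  - (+ sumFin (λ i → 2 ^ (n ∸ suc (toℕ i)) ℕ.* bit (parityOn (R i) x)))

IsMatousekFamily : ∀ {n} → (Fin n → Subset n) → Set
IsMatousekFamily {n} R =
  (∀ i → i ∈ R i) × (∀ i j → j ∈ R i → toℕ j ℕ.≤ toℕ i)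

Smooth : ∀ {n} → (Fin n → Fin n → Set) → (Point n → ℤ) → Set
Smooth {n} _≺_ f =
  ∃ λ (x* : Point n) → ∀ (j : Fin n) (x : Point n) →
    (∀ i → i ≺ j → lookup x i ≡ lookup x* i) →
    f (x [ j ]≔ lookup x* j) > f (x [ j ]≔ not (lookup x* j))

-- The face {0,1}^S y, with y given as a full point whose coordinates in S are ignored.
InFace : ∀ {n} → Subset n → Point n → Point n → Set
InFace S y x = ∀ i → i ∉ S → lookup x i ≡ lookup y i

LocalPeak : ∀ {n} → (Point n → ℤ) → Subset n → Point n → Point n → Set
LocalPeak f S y x =
  InFace S y x × (∀ i → i ∈ S → f x ≥ f (x [ i ]≔ not (lookup x i)))

Semismooth : ∀ {n} → (Point n → ℤ) → Set
Semismooth {n} f = ∀ (S : Subset n) (y : Point n) → ∃! _≡_ (LocalPeak f S y)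

{-# OPTIONS --safe #-}
module Submission where

-- Write Pᵢ(x) for the parity of x on Rᵢ. Then f(x) = −Σ 2^(n−i) Pᵢ(x) is minus the binary number
-- P₁(x)…Pₙ(x), so f compares points lexicographically by their parity vectors. As i ∈ Rᵢ ⊆ [i],
-- Pᵢ depends only on x₁,…,xᵢ and changes whenever xᵢ does; hence if x and x′ agree below i and
-- differ at i, then f(x) > f(x′) exactly when Pᵢ(x) = 0. The local peaks of a face {0,1}^S y are
-- therefore the points of the face with Pᵢ = 0 for all i ∈ S: one is reached by fixing the
-- coordinates in S in increasing order, and any two agree coordinatewise by induction on i.
-- The peak of the whole cube is the x* witnessing <-smoothness.

open import Defs
open import Data.Nat using (ℕ)
open import Data.Fin using (Fin; _<_)
open import Data.Fin.Subset using (Subset)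
open import Data.Product using (_×_)

open import Data.Bool using (Bool; true; false; not; _xor_; _∧_)
open import Data.Bool.Properties
  using (not-distribˡ-xor; not-distribʳ-xor; not-involutive; ¬-not; not-¬) renaming (_≟_ to _≟ᵇ_)
open import Data.Empty using (⊥-elim)
open import Function using (_∘_)
open import Data.Fin using (toℕ; fromℕ<; _≤_) renaming (zero to fzero; suc to fsuc)
open import Data.Fin.Induction using (<-wellFounded)
open import Data.Fin.Properties
  using (toℕ<n; toℕ-fromℕ<; suc-injective; <⇒≢; ≤∧≢⇒<) renaming (_≟_ to _≟ᶠ_)
open import Data.Fin.Subset using (_∈_; ⊤)
open import Data.Fin.Subset.Properties using (_∈?_; ∈⊤)
open import Data.Integer using (ℤ; +<+; _≥_; _>_)
open import Data.Integer.Properties using (neg-mono-<; <⇒≤; <⇒≱)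
open import Data.Nat as ℕ using (suc; zero; _^_; _∸_; _+_; _*_; z≤n; s≤s; s≤s⁻¹)
import Data.Nat.Properties as ℕₚ
open import Data.Product using (∃; _,_; proj₁; proj₂)
open import Data.Vec using (lookup; replicate; tabulate; _[_]≔_)
open import Data.Vec.Properties
  using (lookup∘update; lookup∘update′; lookup⇒[]=; []=⇒lookup; tabulate∘lookup; tabulate-cong)
open import Induction.WellFounded using (module All)
open import Level using (0ℓ)
open import Relation.Nullary using (yes; no)
open import Relation.Binary.PropositionalEquality

binaryValue : ∀ {n} → (Fin n → Bool) → ℕ
binaryValue {n} a = sumFin (λ k → 2 ^ (n ∸ suc (toℕ k)) * bit (a k))

*-bit-≤ : ∀ m b → m * bit b ℕ.≤ m
*-bit-≤ m true  = ℕₚ.≤-reflexive (ℕₚ.*-identityʳ m)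
*-bit-≤ m false = subst (ℕ._≤ m) (sym (ℕₚ.*-zeroʳ m)) z≤n

binaryValue<2^n : ∀ {n} (a : Fin n → Bool) → binaryValue a ℕ.< 2 ^ n
binaryValue<2^n {zero}  a = s≤s z≤n
binaryValue<2^n {suc n} a =
  subst (binaryValue a ℕ.<_) (cong (2 ^ n +_) (sym (ℕₚ.+-identityʳ (2 ^ n))))
    (ℕₚ.+-mono-≤-< (*-bit-≤ (2 ^ n) (a fzero)) (binaryValue<2^n (λ k → a (fsuc k))))

binaryValue-lex-< : ∀ {n} (a b : Fin n → Bool) (i : Fin n) →
  (∀ k → k < i → a k ≡ b k) → a i ≡ false → b i ≡ true →
  binaryValue a ℕ.< binaryValue b
binaryValue-lex-< {suc n} a b fzero _ aᵢ≡false bᵢ≡true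
  rewrite aᵢ≡false | bᵢ≡true | ℕₚ.*-zeroʳ (2 ^ n) | ℕₚ.*-identityʳ (2 ^ n) =
  ℕₚ.<-≤-trans (binaryValue<2^n (λ k → a (fsuc k))) (ℕₚ.m≤m+n _ _)
binaryValue-lex-< {suc n} a b (fsuc i) a≡b aᵢ≡false bᵢ≡true
  rewrite a≡b fzero (s≤s z≤n) =
  ℕₚ.+-monoʳ-< (2 ^ n * bit (b fzero))
    (binaryValue-lex-< (λ k → a (fsuc k)) (λ k → b (fsuc k)) i
      (λ k k<i → a≡b (fsuc k) (s≤s k<i)) aᵢ≡false bᵢ≡true)

parityFin-cong : ∀ {n} {b b′ : Fin n → Bool} → (∀ j → b j ≡ b′ j) →
  parityFin b ≡ parityFin b′
parityFin-cong {zero}  _   = refl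
parityFin-cong {suc n} b≗b′ = cong₂ _xor_ (b≗b′ fzero) (parityFin-cong (λ j → b≗b′ (fsuc j)))

parityFin-flip : ∀ {n} (b b′ : Fin n → Bool) (j : Fin n) →
  (∀ k → k ≢ j → b k ≡ b′ k) → b′ j ≡ not (b j) →
  parityFin b′ ≡ not (parityFin b)
parityFin-flip {suc n} b b′ fzero b≡b′ b′ⱼ≡not
  rewrite b′ⱼ≡not | parityFin-cong {b = λ k → b (fsuc k)} {b′ = λ k → b′ (fsuc k)}
                                   (λ k → b≡b′ (fsuc k) λ ()) =
  sym (not-distribˡ-xor (b fzero) _)
parityFin-flip {suc n} b b′ (fsuc j) b≡b′ b′ⱼ≡not
  rewrite b≡b′ fzero (λ ())
        | parityFin-flip (λ k → b (fsuc k)) (λ k → b′ (fsuc k)) j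
            (λ k k≢j → b≡b′ (fsuc k) (k≢j ∘ suc-injective)) b′ⱼ≡not =
  sym (not-distribʳ-xor (b′ fzero) _)

parityOn-cong : ∀ {n} (S : Subset n) (x x′ : Point n) →
  (∀ j → j ∈ S → lookup x j ≡ lookup x′ j) → parityOn S x ≡ parityOn S x′
parityOn-cong S x x′ agree = parityFin-cong termwise
  where
  termwise : ∀ j → (lookup S j ∧ lookup x j) ≡ (lookup S j ∧ lookup x′ j)
  termwise j with lookup S j in Sⱼ
  ... | true  = agree j (lookup⇒[]= j S Sⱼ)
  ... | false = refl

parityOn-flip : ∀ {n} (S : Subset n) (x x′ : Point n) {j : Fin n} → j ∈ S →
  (∀ k → k ∈ S → k ≢ j → lookup x k ≡ lookup x′ k) → lookup x′ j ≡ not (lookup x j) →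
  parityOn S x′ ≡ not (parityOn S x)
parityOn-flip S x x′ {j} j∈S agree x′ⱼ≡not = parityFin-flip _ _ j termwise flipped
  where
  termwise : ∀ k → k ≢ j → (lookup S k ∧ lookup x k) ≡ (lookup S k ∧ lookup x′ k)
  termwise k k≢j with lookup S k in Sₖ
  ... | true  = agree k (lookup⇒[]= k S Sₖ) k≢j
  ... | false = refl
  flipped : (lookup S j ∧ lookup x′ j) ≡ not (lookup S j ∧ lookup x j)
  flipped rewrite []=⇒lookup j∈S = x′ⱼ≡not

record AgreeBelow {n} (i : Fin n) (x x′ : Point n) : Set where
  constructor agreeBelow
  field
    agreeAt : ∀ k → k < i → lookup x k ≡ lookup x′ k

open AgreeBelow

AgreeBelow-refl : ∀ {n} {i : Fin n} {x : Point n} → AgreeBelow i x x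
AgreeBelow-refl = agreeBelow λ _ _ → refl

AgreeBelow-sym : ∀ {n} {i : Fin n} {x x′ : Point n} → AgreeBelow i x x′ → AgreeBelow i x′ x
AgreeBelow-sym agree = agreeBelow λ k k<i → sym (agreeAt agree k k<i)

AgreeBelow-trans : ∀ {n} {i : Fin n} {x x′ x″ : Point n} →
  AgreeBelow i x x′ → AgreeBelow i x′ x″ → AgreeBelow i x x″
AgreeBelow-trans agree agree′ =
  agreeBelow λ k k<i → trans (agreeAt agree k k<i) (agreeAt agree′ k k<i)

AgreeBelow-[]≔ : ∀ {n} (x : Point n) (i : Fin n) (b : Bool) → AgreeBelow i x (x [ i ]≔ b)
AgreeBelow-[]≔ x i b = agreeBelow λ k k<i → sym (lookup∘update′ (<⇒≢ k<i) x b)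

AgreeBelow-mono : ∀ {n} {i j : Fin n} {x x′ : Point n} →
  j ≤ i → AgreeBelow i x x′ → AgreeBelow j x x′
AgreeBelow-mono j≤i agree = agreeBelow λ k k<j → agreeAt agree k (ℕₚ.<-≤-trans k<j j≤i)

AgreeBelow-upTo : ∀ {n} {i : Fin n} {x x′ : Point n} →
  AgreeBelow i x x′ → lookup x i ≡ lookup x′ i → ∀ k → k ≤ i → lookup x k ≡ lookup x′ k
AgreeBelow-upTo {i = i} agree xᵢ≡x′ᵢ k k≤i with k ≟ᶠ i
... | yes refl = xᵢ≡x′ᵢ
... | no k≢i   = agreeAt agree k (≤∧≢⇒< k≤i k≢i)

lookup-extensionality : ∀ {n} {x x′ : Point n} → (∀ k → lookup x k ≡ lookup x′ k) → x ≡ x′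
lookup-extensionality {x = x} {x′} x≗x′ = begin
  x                   ≡⟨ sym (tabulate∘lookup x) ⟩
  tabulate (lookup x)  ≡⟨ tabulate-cong x≗x′ ⟩
  tabulate (lookup x′) ≡⟨ tabulate∘lookup x′ ⟩
  x′                  ∎
  where open ≡-Reasoning

flip : ∀ {n} → Point n → Fin n → Point n
flip x i = x [ i ]≔ not (lookup x i)

InFace-flip : ∀ {n} {S : Subset n} {y x : Point n} {i : Fin n} →
  i ∈ S → InFace S y x → InFace S y (flip x i)
InFace-flip {x = x} i∈S inFace k k∉S =
  trans (lookup∘update′ (λ { refl → k∉S i∈S }) x _) (inFace k k∉S)

module Matousek {n} (R : Fin n → Subset n) (isFamily : IsMatousekFamily R) where

  f : Point n → ℤ
  f = matousek R

  P : Fin n → Point n → Bool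
  P i = parityOn (R i)

  P-cong : ∀ {i x x′} → AgreeBelow i x x′ → lookup x i ≡ lookup x′ i → P i x ≡ P i x′
  P-cong {i} {x} {x′} agree xᵢ≡x′ᵢ =
    parityOn-cong (R i) x x′ (λ k k∈Rᵢ → AgreeBelow-upTo agree xᵢ≡x′ᵢ k (proj₂ isFamily i k k∈Rᵢ))

  P-flip : ∀ {i x x′} → AgreeBelow i x x′ → lookup x′ i ≡ not (lookup x i) →
    P i x′ ≡ not (P i x)
  P-flip {i} {x} {x′} agree =
    parityOn-flip (R i) x x′ (proj₁ isFamily i)
      (λ k k∈Rᵢ k≢i → agreeAt agree k (≤∧≢⇒< (proj₂ isFamily i k k∈Rᵢ) k≢i))

  P≡false⇒f> : ∀ {i x x′} → AgreeBelow i x x′ → lookup x′ i ≡ not (lookup x i) →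
    P i x ≡ false → f x > f x′
  P≡false⇒f> {i} {x} {x′} agree x′ᵢ≡not Pᵢx≡false =
    neg-mono-< (+<+ (binaryValue-lex-< (λ k → P k x) (λ k → P k x′) i
      (λ k k<i → P-cong {k} (AgreeBelow-mono (ℕₚ.<⇒≤ k<i) agree) (agreeAt agree k k<i))
      Pᵢx≡false
      (trans (P-flip agree x′ᵢ≡not) (cong not Pᵢx≡false))))

  lookup-flip : ∀ (x : Point n) i → lookup (flip x i) i ≡ not (lookup x i)
  lookup-flip x i = lookup∘update i x (not (lookup x i))

  flip-agreeBelow : ∀ (x : Point n) i → AgreeBelow i x (flip x i)
  flip-agreeBelow x i = AgreeBelow-[]≔ x i (not (lookup x i))

  P-of-flip : ∀ (x : Point n) i → P i (flip x i) ≡ not (P i x)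
  P-of-flip x i = P-flip (flip-agreeBelow x i) (lookup-flip x i)

  P≡false⇒≥flip : ∀ (x : Point n) i → P i x ≡ false → f x ≥ f (flip x i)
  P≡false⇒≥flip x i Pᵢx≡false = <⇒≤ (P≡false⇒f> (flip-agreeBelow x i) (lookup-flip x i) Pᵢx≡false)

  ≥flip⇒P≡false : ∀ (x : Point n) i → f x ≥ f (flip x i) → P i x ≡ false
  ≥flip⇒P≡false x i fx≥ with P i x in Pᵢx
  ... | false = refl
  ... | true  =
    ⊥-elim (<⇒≱ (P≡false⇒f> (AgreeBelow-sym (flip-agreeBelow x i)) flipBack PᵢFlip≡false) fx≥)
    where
    flipBack : lookup x i ≡ not (lookup (flip x i) i)
    flipBack = sym (trans (cong not (lookup-flip x i)) (not-involutive (lookup x i)))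
    PᵢFlip≡false : P i (flip x i) ≡ false
    PᵢFlip≡false = trans (P-of-flip x i) (cong not Pᵢx)

  Settled : Subset n → Point n → Set
  Settled S x = ∀ i → i ∈ S → P i x ≡ false

  SettledBelow : Subset n → Point n → ℕ → Set
  SettledBelow S x m = ∀ i → i ∈ S → toℕ i ℕ.< m → P i x ≡ false

  module _ (S : Subset n) (y : Point n) where

    LocalPeak⇒Settled : ∀ x → LocalPeak f S y x → Settled S x
    LocalPeak⇒Settled x (_ , peak) i i∈S = ≥flip⇒P≡false x i (peak i i∈S)

    Settled⇒LocalPeak : ∀ x → InFace S y x → Settled S x → LocalPeak f S y x
    Settled⇒LocalPeak x inFace settled = inFace , λ i i∈S → P≡false⇒≥flip x i (settled i i∈S)

    SettledBelow-cong : ∀ x x′ {k} → AgreeBelow k x x′ →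
      SettledBelow S x (toℕ k) → SettledBelow S x′ (toℕ k)
    SettledBelow-cong x x′ agree settled i i∈S i<k =
      trans (sym (P-cong {i} (AgreeBelow-mono (ℕₚ.<⇒≤ i<k) agree) (agreeAt agree i i<k)))
            (settled i i∈S i<k)

    SettledBelow-suc : ∀ x k → SettledBelow S x (toℕ k) → (k ∈ S → P k x ≡ false) →
      SettledBelow S x (suc (toℕ k))
    SettledBelow-suc x k settled settledAtK i i∈S i≤k with i ≟ᶠ k
    ... | yes refl = settledAtK i∈S
    ... | no i≢k   = settled i i∈S (≤∧≢⇒< (s≤s⁻¹ i≤k) i≢k)

    settleCoordinate : ∀ x k → InFace S y x →
      ∃ λ x′ → InFace S y x′ × AgreeBelow k x x′ × (k ∈ S → P k x′ ≡ false)
    settleCoordinate x k inFace with k ∈? S | P k x in Pₖx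
    ... | no k∉S  | _     = x , inFace , AgreeBelow-refl , λ k∈S → ⊥-elim (k∉S k∈S)
    ... | yes _   | false = x , inFace , AgreeBelow-refl , λ _ → Pₖx
    ... | yes k∈S | true  =
      flip x k , InFace-flip {y = y} {x = x} k∈S inFace , flip-agreeBelow x k ,
      λ _ → trans (P-of-flip x k) (cong not Pₖx)

    settledBelow-exists : ∀ m → m ℕ.≤ n → ∃ λ x → InFace S y x × SettledBelow S x m
    settledBelow-exists zero    _ = y , (λ _ _ → refl) , λ _ _ ()
    settledBelow-exists (suc m) m<n
      with fromℕ< m<n | toℕ-fromℕ< m<n | settledBelow-exists m (ℕₚ.<⇒≤ m<n)
    ... | k | refl | x , inFace , settled with settleCoordinate x k inFace
    ...   | x′ , inFace′ , agree , settledAtK =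
            x′ , inFace′ , SettledBelow-suc x′ k (SettledBelow-cong x x′ agree settled) settledAtK

    settled-exists : ∃ λ x → InFace S y x × Settled S x
    settled-exists with settledBelow-exists n ℕₚ.≤-refl
    ... | x , inFace , settled = x , inFace , λ i i∈S → settled i i∈S (toℕ<n i)

    settled-lookup-unique : ∀ x x′ {k} → InFace S y x → InFace S y x′ →
      Settled S x → Settled S x′ → AgreeBelow k x x′ → lookup x k ≡ lookup x′ k
    settled-lookup-unique x x′ {k} inFace inFace′ settled settled′ agree with k ∈? S
    ... | no k∉S = trans (inFace k k∉S) (sym (inFace′ k k∉S))
    ... | yes k∈S with lookup x k ≟ᵇ lookup x′ k
    ...   | yes xₖ≡x′ₖ = xₖ≡x′ₖ
    ...   | no xₖ≢x′ₖ =
            ⊥-elim (not-¬ (trans (settled k k∈S) (sym (settled′ k k∈S)))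
                          (P-flip (AgreeBelow-sym agree) (¬-not xₖ≢x′ₖ)))

    settled-unique : ∀ x x′ → InFace S y x → InFace S y x′ → Settled S x → Settled S x′ → x ≡ x′
    settled-unique x x′ inFace inFace′ settled settled′ =
      lookup-extensionality (All.wfRec <-wellFounded 0ℓ (λ k → lookup x k ≡ lookup x′ k)
        λ k agreeBelowK → settled-lookup-unique x x′ inFace inFace′ settled settled′
                            (agreeBelow λ j j<k → agreeBelowK j<k))

  semismooth : Semismooth f
  semismooth S y with settled-exists S y
  ... | x , inFace , settled =
        x , Settled⇒LocalPeak S y x inFace settled ,
        λ {x′} peak →
          settled-unique S y x x′ inFace (proj₁ peak) settled (LocalPeak⇒Settled S y x′ peak)

  smooth : Smooth _<_ f
  smooth with settled-exists ⊤ (replicate n false)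
  ... | x* , _ , settled* = x* , beats
    where
    beats : ∀ j x → (∀ i → i < j → lookup x i ≡ lookup x* i) →
      f (x [ j ]≔ lookup x* j) > f (x [ j ]≔ not (lookup x* j))
    beats j x agree* = P≡false⇒f> toggled x₂ⱼ≡not Pⱼx₁≡false
      where
      x₁ x₂ : Point n
      x₁ = x [ j ]≔ lookup x* j
      x₂ = x [ j ]≔ not (lookup x* j)
      toggled : AgreeBelow j x₁ x₂
      toggled = AgreeBelow-trans (AgreeBelow-sym (AgreeBelow-[]≔ x j (lookup x* j)))
                                 (AgreeBelow-[]≔ x j (not (lookup x* j)))
      x₂ⱼ≡not : lookup x₂ j ≡ not (lookup x₁ j)
      x₂ⱼ≡not = trans (lookup∘update j x (not (lookup x* j)))
                      (cong not (sym (lookup∘update j x (lookup x* j))))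
      x≈x* : AgreeBelow j x x*
      x≈x* = agreeBelow agree*
      Pⱼx₁≡false : P j x₁ ≡ false
      Pⱼx₁≡false =
        trans (P-cong (AgreeBelow-trans (AgreeBelow-sym (AgreeBelow-[]≔ x j (lookup x* j))) x≈x*)
                      (lookup∘update j x (lookup x* j)))
              (settled* j ∈⊤)

corollary6p6 : ∀ (n : ℕ) (R : Fin n → Subset n) → IsMatousekFamily R →
    Smooth _<_ (matousek R) × Semismooth (matousek R)
corollary6p6 n R isFamily = Matousek.smooth R isFamily , Matousek.semismooth R isFamily
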